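{- Let $a,b,\alpha,\beta$ be nonnegative integers such that $|a-b|=1$, $\alpha a+\beta b$ is even, and $3a+3b<\alpha+\beta-1$. Then there exists an $(\alpha,a,\beta,b)$-graph.
   Context: For nonnegative integers $\alpha,a,\beta,b$, an $(\alpha,a,\beta,b)$-graph is a triangle-free graph with $\alpha+\beta$ vertices which has $\alpha$ vertices of degree $a$ and $\beta$ vertices of degree $b$ if $a\ne b$, and is $a$-regular if $a=b$. -}

module Defs where

open import Data.Nat using (ℕ; _≟_)
open import Data.Bool using (Bool; true; false)
open import Data.Fin using (Fin)
open import Data.List using (List; filter; length)
open import Data.List.Base using (allFin)
open import Data.Product using (_×_)
open import Relation.Binary.PropositionalEquality using (_≡_)
open import Relation.Nullary using (¬_)
open import Relation.Nullary.Decidable using (⌊_⌋)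
open import Data.Bool using (T)

record Graph (n : ℕ) : Set where
  field
    adj   : Fin n → Fin n → Bool
    sym   : ∀ u v → adj u v ≡ adj v u
    irref : ∀ v → adj v v ≡ false

open Graph public

degree : ∀ {n} → Graph n → Fin n → ℕ
degree G v = length (filter (λ u → T? (adj G v u)) (allFin _))
  where
  open import Data.Bool using (T?)

TriangleFree : ∀ {n} → Graph n → Set
TriangleFree {n} G =
  ∀ (u v w : Fin n) → ¬ (T (adj G u v) × T (adj G v w) × T (adj G u w))

countDeg : ∀ {n} → Graph n → ℕ → ℕ
countDeg G d = length (filter (λ v → degree G v ≟ d) (allFin _))

IsABGraph : (α a β b : ℕ) → Graph (α Data.Nat.+ β) → Set
IsABGraph α a β b G with a ≟ b
... | Relation.Nullary.yes _ = TriangleFree G × (∀ v → degree G v ≡ a)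
... | Relation.Nullary.no _  = TriangleFree G × countDeg G a ≡ α × countDeg G b ≡ β

-- Put the vertices on 0, …, n−1 and join u and v when ∣u − v∣ lies in a set D of distances that is
-- invariant under t ↦ n − t and contained in the open middle third (n/3, 2n/3). Such a graph is
-- triangle-free, because on a line the longest side of a triangle is the sum of the other two; and the
-- symmetry of D makes it regular of degree ∣D ∩ [1, n)∣. Taking D to be one interval centred at n/2,
-- or two intervals around a hole at n/2, realises every degree of the right parity. A second degree
-- comes from toggling the s edges {x, x + g}, x < s, for one more middle-third distance g near n/2:
-- if g ∈ D this removes them and 2s vertices drop from d + 1 to d, otherwise it adds them and 2s
-- vertices rise from d to d + 1. The parities of the order, of d and of the two multiplicities
-- decide which shape and which move to use.

module Submission where

open import Defs hiding (sym)
open import Data.Bool using (Bool; true; false; _∧_; _∨_; _xor_; not; T; T?; if_then_else_)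
open import Data.Bool.Properties using (∧-zeroʳ; ∧-identityʳ; ∧-comm; ∨-comm; T-∧)
open import Data.Empty using (⊥; ⊥-elim)
open import Data.Fin as Fin using (Fin; toℕ)
open import Data.List using (filter; length; tabulate; _∷_; [])
open import Data.List.Base using (allFin)
open import Data.List.Properties using (length-tabulate)
open import Data.Nat using (ℕ; zero; suc; _+_; _*_; _∸_; _≤_; _<_; z≤n; s≤s; s≤s⁻¹; z<s;
                            _≟_; _≤?_; _≤ᵇ_; _<ᵇ_; _≡ᵇ_; _⊓_; ∣_-_∣)
open import Data.Nat.Divisibility using (_∣_; divides)
open import Data.Nat.Properties
open import Algebra.Properties.CommutativeSemigroup +-commutativeSemigroup
  using () renaming (interchange to +-interchange)
open import Data.Nat.Tactic.RingSolver using (solve)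
open import Data.Product using (Σ; _×_; _,_; proj₁; proj₂)
open import Data.Sum using (_⊎_; inj₁; inj₂)
open import Data.Unit using (tt)
open import Function using (_∘_; id)
open import Function.Bundles using (Equivalence)
open import Level using (0ℓ)
open import Relation.Binary.PropositionalEquality
open import Relation.Nullary using (¬_; yes; no; does; contradiction)
open import Relation.Nullary.Reflects using (ofʸ; ofⁿ; det; fromEquivalence)
open import Relation.Unary using (Pred; Decidable)

∑< : ℕ → (ℕ → ℕ) → ℕ
∑< zero    f = 0
∑< (suc m) f = ∑< m f + f m

syntax ∑< m (λ i → e) = ∑[ i < m ] e

∑<-shift : ∀ m f → ∑< (suc m) f ≡ f 0 + ∑[ i < m ] f (suc i)
∑<-shift zero    f = +-comm 0 (f 0)
∑<-shift (suc m) f = trans (cong (_+ f (suc m)) (∑<-shift m f)) (+-assoc (f 0) _ _)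

∑<-cong : ∀ m {f g} → (∀ i → i < m → f i ≡ g i) → ∑< m f ≡ ∑< m g
∑<-cong zero    f≗g = refl
∑<-cong (suc m) f≗g = cong₂ _+_ (∑<-cong m (λ i i<m → f≗g i (m<n⇒m<1+n i<m))) (f≗g m (n<1+n m))

∑<-zero : ∀ m f → (∀ i → i < m → f i ≡ 0) → ∑< m f ≡ 0
∑<-zero zero    f f≗0 = refl
∑<-zero (suc m) f f≗0 = cong₂ _+_ (∑<-zero m f (λ i i<m → f≗0 i (m<n⇒m<1+n i<m))) (f≗0 m (n<1+n m))

∑<-distrib-+ : ∀ m f g → ∑[ i < m ] (f i + g i) ≡ ∑< m f + ∑< m g
∑<-distrib-+ zero    f g = refl
∑<-distrib-+ (suc m) f g =
  trans (cong (_+ (f m + g m)) (∑<-distrib-+ m f g)) (+-interchange (∑< m f) (∑< m g) (f m) (g m))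

∑<-split : ∀ m k f → ∑< (m + k) f ≡ ∑< m f + ∑[ j < k ] f (m + j)
∑<-split m zero    f = trans (cong (λ x → ∑< x f) (+-identityʳ m)) (sym (+-identityʳ _))
∑<-split m (suc k) f = trans (cong (λ x → ∑< x f) (+-suc m k))
  (trans (cong (_+ f (m + k)) (∑<-split m k f)) (+-assoc (∑< m f) _ _))

∑<-reverse : ∀ m f g → (∀ i j → suc (i + j) ≡ m → f i ≡ g j) → ∑< m f ≡ ∑< m g
∑<-reverse zero    f g f≗g = refl
∑<-reverse (suc m) f g f≗g = begin
  ∑< m f + f m                     ≡⟨ cong₂ _+_ (∑<-reverse m f (λ j → g (suc j)) shifted)
                                                (f≗g m 0 (cong suc (+-identityʳ m))) ⟩
  ∑[ j < m ] g (suc j) + g 0       ≡⟨ +-comm _ (g 0) ⟩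
  g 0 + ∑[ j < m ] g (suc j)       ≡⟨ ∑<-shift m g ⟨
  ∑< (suc m) g                     ∎
  where
  open ≡-Reasoning
  shifted : ∀ i j → suc (i + j) ≡ m → f i ≡ g (suc j)
  shifted i j eq = f≗g i (suc j) (cong suc (trans (+-suc i j) eq))

∑<-single : ∀ m c f → c < m → (∀ i → i < m → i ≢ c → f i ≡ 0) → ∑< m f ≡ f c
∑<-single (suc m) c f c<1+m f≗0 with m ≟ c
... | yes refl = cong (_+ f m) (∑<-zero m f (λ i i<m → f≗0 i (m<n⇒m<1+n i<m) (<⇒≢ i<m)))
... | no m≢c   = trans (cong₂ _+_ (∑<-single m c f c<m (λ i i<m → f≗0 i (m<n⇒m<1+n i<m))) (f≗0 m (n<1+n m) m≢c))
                       (+-identityʳ (f c))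
  where
  c<m : c < m
  c<m = ≤∧≢⇒< (s≤s⁻¹ c<1+m) (≢-sym m≢c)

iverson : Bool → ℕ
iverson true  = 1
iverson false = 0

iverson-∨ : ∀ p q → (T p → T q → ⊥) → iverson p + iverson q ≡ iverson (p ∨ q)
iverson-∨ true  true  p∧q = ⊥-elim (p∧q tt tt)
iverson-∨ true  false _   = refl
iverson-∨ false q     _   = refl

iverson-xor-cancel : ∀ p q → (T q → T p) → iverson (p xor q) + iverson q ≡ iverson p
iverson-xor-cancel true  true  _   = refl
iverson-xor-cancel true  false _   = refl
iverson-xor-cancel false true  q⇒p = ⊥-elim (q⇒p tt)
iverson-xor-cancel false false _   = refl

iverson-xor-disjoint : ∀ p q → (T q → ¬ T p) → iverson p + iverson q ≡ iverson (p xor q)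
iverson-xor-disjoint true  true  q⇒¬p = ⊥-elim (q⇒¬p tt tt)
iverson-xor-disjoint true  false _    = refl
iverson-xor-disjoint false q     _    = refl

iverson-cancelʳ : ∀ {k d} b → k + iverson b ≡ suc d → k ≡ (if b then d else suc d)
iverson-cancelʳ {k} true  k+1≡1+d = suc-injective (trans (+-comm 1 k) k+1≡1+d)
iverson-cancelʳ {k} false k+0≡1+d = trans (sym (+-identityʳ k)) k+0≡1+d

iverson-offset : ∀ {k d} b → k ≡ d + iverson b → k ≡ (if b then suc d else d)
iverson-offset {d = d} true  k≡d+1 = trans k≡d+1 (+-comm d 1)
iverson-offset {d = d} false k≡d+0 = trans k≡d+0 (+-identityʳ d)

≡ᵇ-refl : ∀ z → (z ≡ᵇ z) ≡ true
≡ᵇ-refl z = det (fromEquivalence (≡ᵇ⇒≡ z z) (≡⇒≡ᵇ z z)) (ofʸ refl)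

≢⇒≡ᵇ-false : ∀ {z w} → z ≢ w → (z ≡ᵇ w) ≡ false
≢⇒≡ᵇ-false {z} {w} z≢w = det (fromEquivalence (≡ᵇ⇒≡ z w) (≡⇒≡ᵇ z w)) (ofⁿ z≢w)

count : ℕ → (ℕ → Bool) → ℕ
count m P = ∑[ i < m ] iverson (P i)

count-none : ∀ m P → (∀ i → i < m → P i ≡ false) → count m P ≡ 0
count-none m P P≗false = ∑<-zero m _ (λ i i<m → cong iverson (P≗false i i<m))

count-all : ∀ m P → (∀ i → i < m → P i ≡ true) → count m P ≡ m
count-all zero    P P≗true = refl
count-all (suc m) P P≗true =
  trans (cong₂ _+_ (count-all m P (λ i i<m → P≗true i (m<n⇒m<1+n i<m))) (cong iverson (P≗true m (n<1+n m))))
        (+-comm m 1)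

count-+ : ∀ m P Q R → (∀ i → iverson (P i) + iverson (Q i) ≡ iverson (R i)) → count m P + count m Q ≡ count m R
count-+ m P Q R pointwise = trans (sym (∑<-distrib-+ m _ _)) (∑<-cong m (λ i _ → pointwise i))

count-∨ : ∀ m P Q → (∀ i → T (P i) → T (Q i) → ⊥) → count m (λ i → P i ∨ Q i) ≡ count m P + count m Q
count-∨ m P Q disjoint = sym (count-+ m P Q _ (λ i → iverson-∨ (P i) (Q i) (disjoint i)))

count-not : ∀ m P → count m (λ i → not (P i)) + count m P ≡ m
count-not m P = trans (count-+ m _ P (λ _ → true) (λ i → pointwise (P i))) (count-all m _ (λ _ _ → refl))
  where
  pointwise : ∀ p → iverson (not p) + iverson p ≡ 1
  pointwise true  = refl
  pointwise false = refl

count-dichotomy : ∀ m (f : ℕ → ℕ) (P : ℕ → Bool) {x y} → x ≢ y →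
                  (∀ v → v < m → f v ≡ (if P v then x else y)) →
                  count m (λ v → f v ≡ᵇ x) ≡ count m P × count m (λ v → f v ≡ᵇ y) + count m P ≡ m
count-dichotomy m f P {x} {y} x≢y f≗ =
  ∑<-cong m (λ v v<m → cong iverson (at-x v (f≗ v v<m))) ,
  trans (cong (_+ count m P) (∑<-cong m (λ v v<m → cong iverson (at-y v (f≗ v v<m))))) (count-not m P)
  where
  at-x : ∀ v → f v ≡ (if P v then x else y) → (f v ≡ᵇ x) ≡ P v
  at-x v eq with P v
  ... | true  rewrite eq = ≡ᵇ-refl x
  ... | false rewrite eq = ≢⇒≡ᵇ-false (≢-sym x≢y)
  at-y : ∀ v → f v ≡ (if P v then x else y) → (f v ≡ᵇ y) ≡ not (P v)
  at-y v eq with P v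
  ... | true  rewrite eq = ≢⇒≡ᵇ-false x≢y
  ... | false rewrite eq = ≡ᵇ-refl y

inRange : ℕ → ℕ → ℕ → Bool
inRange a b t = (a ≤ᵇ t) ∧ (t <ᵇ b)

inRange⁺ : ∀ {a b t} → a ≤ t → t < b → inRange a b t ≡ true
inRange⁺ {a} {b} {t} a≤t t<b with a ≤ᵇ t | ≤ᵇ-reflects-≤ a t | t <ᵇ b | <ᵇ-reflects-< t b
... | true  | _        | true  | _        = refl
... | false | ofⁿ a≰t | _     | _        = contradiction a≤t a≰t
... | true  | _        | false | ofⁿ t≮b  = contradiction t<b t≮b

inRange⁻ : ∀ {a b t} → T (inRange a b t) → a ≤ t × t < b
inRange⁻ {a} {b} {t} t∈I with a ≤ᵇ t | ≤ᵇ-reflects-≤ a t | t <ᵇ b | <ᵇ-reflects-< t b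
... | true | ofʸ a≤t | true | ofʸ t<b = a≤t , t<b

inRange-below : ∀ {a b t} → t < a → inRange a b t ≡ false
inRange-below {a} {b} {t} t<a with a ≤ᵇ t | ≤ᵇ-reflects-≤ a t
... | true  | ofʸ a≤t = contradiction a≤t (<⇒≱ t<a)
... | false | _       = refl

inRange-above : ∀ {a b t} → b ≤ t → inRange a b t ≡ false
inRange-above {a} {b} {t} b≤t with t <ᵇ b | <ᵇ-reflects-< t b
... | true  | ofʸ t<b = contradiction t<b (≤⇒≯ b≤t)
... | false | _       = ∧-zeroʳ (a ≤ᵇ t)

inRange-+ : ∀ g s i → inRange g (g + s) (g + i) ≡ (i <ᵇ s)
inRange-+ g s i with i <ᵇ s | <ᵇ-reflects-< i s
... | true  | ofʸ i<s = inRange⁺ (m≤m+n g i) (+-monoʳ-< g i<s)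
... | false | ofⁿ i≮s = inRange-above {a = g} (+-monoʳ-≤ g (≮⇒≥ i≮s))

count-inRange : ∀ {m} a c → a + c ≤ m → count m (inRange a (a + c)) ≡ c
count-inRange {m} a c a+c≤m with m ∸ (a + c) | m+[n∸m]≡n a+c≤m
... | e | refl = begin
  count (a + c + e) I                                 ≡⟨ ∑<-split (a + c) e _ ⟩
  count (a + c) I + count e (λ j → I (a + c + j))     ≡⟨ cong₂ _+_ (∑<-split a c _) (count-none e _ above) ⟩
  count a I + count c (λ j → I (a + j)) + 0           ≡⟨ cong (λ x → x + count c (λ j → I (a + j)) + 0)
                                                              (count-none a I below) ⟩
  count c (λ j → I (a + j)) + 0                       ≡⟨ cong (_+ 0) (count-all c _ inside) ⟩
  c + 0                                               ≡⟨ +-identityʳ c ⟩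
  c                                                   ∎
  where
  open ≡-Reasoning
  I : ℕ → Bool
  I = inRange a (a + c)
  below : ∀ i → i < a → I i ≡ false
  below i i<a = inRange-below {b = a + c} i<a
  inside : ∀ j → j < c → I (a + j) ≡ true
  inside j j<c = inRange⁺ (m≤m+n a j) (+-monoʳ-< a j<c)
  above : ∀ j → j < e → I (a + c + j) ≡ false
  above j _ = inRange-above {a = a} (m≤m+n (a + c) j)

≤ᵇ-reflect : ∀ {n} a b x y → a + b ≡ suc n → x + y ≡ n → (a ≤ᵇ x) ≡ (y <ᵇ b)
≤ᵇ-reflect {n} a b x y a+b≡1+n x+y≡n
  with a ≤ᵇ x | ≤ᵇ-reflects-≤ a x | y <ᵇ b | <ᵇ-reflects-< y b
... | true  | _        | true  | _       = refl
... | false | _        | false | _       = refl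
... | true  | ofʸ a≤x  | false | ofⁿ y≮b = contradiction (+-cancelˡ-≤ a (suc y) b (begin
      a + suc y   ≡⟨ +-suc a y ⟩
      suc (a + y) ≤⟨ s≤s (+-monoˡ-≤ y a≤x) ⟩
      suc (x + y) ≡⟨ cong suc x+y≡n ⟩
      suc n       ≡⟨ a+b≡1+n ⟨
      a + b       ∎)) y≮b
  where open ≤-Reasoning
... | false | ofⁿ a≰x | true  | ofʸ y<b = contradiction (+-cancelʳ-≤ y a x (s≤s⁻¹ (begin
      suc (a + y) ≡⟨ +-suc a y ⟨
      a + suc y   ≤⟨ +-monoʳ-≤ a y<b ⟩
      a + b       ≡⟨ a+b≡1+n ⟩
      suc n       ≡⟨ cong suc x+y≡n ⟨
      suc (x + y) ∎))) a≰x
  where open ≤-Reasoning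

inRange-reflect : ∀ {n a b a′ b′} → a + b′ ≡ suc n → a′ + b ≡ suc n →
                  ∀ x y → x + y ≡ n → inRange a b x ≡ inRange a′ b′ y
inRange-reflect {a = a} {b} {a′} {b′} a+b′≡1+n a′+b≡1+n x y x+y≡n = begin
  (a ≤ᵇ x) ∧ (x <ᵇ b)   ≡⟨ cong₂ _∧_ (≤ᵇ-reflect a b′ x y a+b′≡1+n x+y≡n)
                                     (sym (≤ᵇ-reflect a′ b y x a′+b≡1+n (trans (+-comm y x) x+y≡n))) ⟩
  (y <ᵇ b′) ∧ (a′ ≤ᵇ y) ≡⟨ ∧-comm (y <ᵇ b′) (a′ ≤ᵇ y) ⟩
  (a′ ≤ᵇ y) ∧ (y <ᵇ b′) ∎
  where open ≡-Reasoning

MiddleThird : ℕ → ℕ → Set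
MiddleThird n t = n < 3 * t × 3 * t < 2 * n

n<3a⇒0<a : ∀ {n a} → n < 3 * a → 0 < a
n<3a⇒0<a {a = suc a} _ = z<s

inRange-middleThird : ∀ {n a b a′} → a′ + b ≡ suc n → n < 3 * a → n < 3 * a′ →
                      ∀ t → T (inRange a b t) → MiddleThird n t
inRange-middleThird {n} {a} {b} {a′} a′+b≡1+n n<3a n<3a′ t t∈I with inRange⁻ {a} {b} {t} t∈I
... | a≤t , t<b = <-≤-trans n<3a (*-monoʳ-≤ 3 a≤t) , 3t<2n
  where
  a′+t≤n : a′ + t ≤ n
  a′+t≤n = s≤s⁻¹ (begin
    suc (a′ + t) ≡⟨ +-suc a′ t ⟨
    a′ + suc t   ≤⟨ +-monoʳ-≤ a′ t<b ⟩
    a′ + b       ≡⟨ a′+b≡1+n ⟩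
    suc n        ∎)
    where open ≤-Reasoning
  3t<2n : 3 * t < 2 * n
  3t<2n = +-cancelˡ-< n (3 * t) (2 * n) (begin-strict
    n + 3 * t      <⟨ +-monoˡ-< (3 * t) n<3a′ ⟩
    3 * a′ + 3 * t ≡⟨ *-distribˡ-+ 3 a′ t ⟨
    3 * (a′ + t)   ≤⟨ *-monoʳ-≤ 3 a′+t≤n ⟩
    3 * n          ∎)
    where open ≤-Reasoning

middleThird-sum : ∀ {n} i j → MiddleThird n i → MiddleThird n j → ¬ MiddleThird n (i + j)
middleThird-sum {n} i j (n<3i , _) (n<3j , _) (_ , 3[i+j]<2n) = <-irrefl refl (begin-strict
  n + n           <⟨ +-mono-< n<3i n<3j ⟩
  3 * i + 3 * j   ≡⟨ *-distribˡ-+ 3 i j ⟨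
  3 * (i + j)     <⟨ 3[i+j]<2n ⟩
  2 * n           ≡⟨ cong (n +_) (+-identityʳ n) ⟩
  n + n           ∎)
  where open ≤-Reasoning

module _ {n : ℕ} where

  private
    Far : ℕ → ℕ → Set
    Far x y = MiddleThird n ∣ x - y ∣

    Far-sym : ∀ x y → Far x y → Far y x
    Far-sym x y = subst (MiddleThird n) (∣-∣-comm x y)

    noTriangle-ordered : ∀ {x y z} → x ≤ y → y ≤ z → Far x y → Far y z → ¬ Far x z
    noTriangle-ordered {x} {y} {z} x≤y y≤z
      with y ∸ x | m+[n∸m]≡n x≤y | z ∸ y | m+[n∸m]≡n y≤z
    ... | i | refl | j | refl
      rewrite ∣m-m+n∣≡n x i | ∣m-m+n∣≡n (x + i) j | +-assoc x i j | ∣m-m+n∣≡n x (i + j)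
      = middleThird-sum i j

  middleThird-noTriangle : ∀ x y z → Far x y → Far y z → ¬ Far x z
  middleThird-noTriangle x y z xy yz xz with ≤-total x y | ≤-total y z | ≤-total x z
  ... | inj₁ x≤y | inj₁ y≤z | _        = noTriangle-ordered x≤y y≤z xy yz xz
  ... | inj₁ x≤y | inj₂ z≤y | inj₁ x≤z = noTriangle-ordered x≤z z≤y xz (Far-sym y z yz) xy
  ... | inj₁ x≤y | inj₂ z≤y | inj₂ z≤x = noTriangle-ordered z≤x x≤y (Far-sym x z xz) xy (Far-sym y z yz)
  ... | inj₂ y≤x | inj₁ y≤z | inj₁ x≤z = noTriangle-ordered y≤x x≤z (Far-sym x y xy) xz yz
  ... | inj₂ y≤x | inj₁ y≤z | inj₂ z≤x = noTriangle-ordered y≤z z≤x yz (Far-sym x z xz) (Far-sym x y xy)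
  ... | inj₂ y≤x | inj₂ z≤y | _        = noTriangle-ordered z≤y y≤x (Far-sym y z yz) (Far-sym x y xy) (Far-sym x z xz)

length-filter-tabulate : ∀ {m} {A : Set} {P : Pred A 0ℓ} (P? : Decidable P) (f : Fin m → A) (Q : ℕ → Bool) →
                         (∀ i → does (P? (f i)) ≡ Q (toℕ i)) → length (filter P? (tabulate f)) ≡ count m Q
length-filter-tabulate {zero}  P? f Q P≗Q = refl
length-filter-tabulate {suc m} P? f Q P≗Q = trans head+tail (sym (∑<-shift m _))
  where
  tail : length (filter P? (tabulate (f ∘ Fin.suc))) ≡ count m (Q ∘ suc)
  tail = length-filter-tabulate P? (f ∘ Fin.suc) (Q ∘ suc) (P≗Q ∘ Fin.suc)
  head+tail : length (filter P? (tabulate f)) ≡ iverson (Q 0) + count m (Q ∘ suc)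
  head+tail rewrite sym (P≗Q Fin.zero) with does (P? (f Fin.zero))
  ... | true  = cong suc tail
  ... | false = tail

length-filter-disjoint : ∀ {A : Set} {P Q : Pred A 0ℓ} (P? : Decidable P) (Q? : Decidable Q) →
                         (∀ x → P x → ¬ Q x) → ∀ xs → length (filter P? xs) + length (filter Q? xs) ≤ length xs
length-filter-disjoint P? Q? disjoint []       = z≤n
length-filter-disjoint P? Q? disjoint (x ∷ xs) with P? x | Q? x | length-filter-disjoint P? Q? disjoint xs
... | yes p | yes q | _  = contradiction q (disjoint x p)
... | yes _ | no _  | ih = s≤s ih
... | no _  | yes _ | ih = subst (_≤ suc (length xs)) (sym (+-suc _ _)) (s≤s ih)
... | no _  | no _  | ih = m≤n⇒m≤1+n ih

countDeg-distinct : ∀ {n} (G : Graph n) {x y} → x ≢ y → countDeg G x + countDeg G y ≤ n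
countDeg-distinct {n} G {x} {y} x≢y = subst (countDeg G x + countDeg G y ≤_) (length-tabulate {n = n} id)
  (length-filter-disjoint _ _ (λ v deg≡x deg≡y → x≢y (trans (sym deg≡x) deg≡y)) (allFin n))

module RelationGraph (n : ℕ) (R : ℕ → ℕ → Bool)
  (R-sym : ∀ u v → R u v ≡ R v u) (R-irrefl : ∀ v → R v v ≡ false) where

  graph : Graph n
  graph = record
    { adj   = λ u v → R (toℕ u) (toℕ v)
    ; sym   = λ u v → R-sym (toℕ u) (toℕ v)
    ; irref = λ v → R-irrefl (toℕ v)
    }

  degree-graph : ∀ v → degree graph v ≡ count n (R (toℕ v))
  degree-graph v = length-filter-tabulate {n} (λ u → T? (R (toℕ v) (toℕ u))) id (R (toℕ v)) (λ _ → refl)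

  countDeg-graph : ∀ d → countDeg graph d ≡ count n (λ v → count n (R v) ≡ᵇ d)
  countDeg-graph d = length-filter-tabulate {n} (λ v → degree graph v ≟ d) id _
    (λ v → cong (λ x → does (x ≟ d)) (degree-graph v))

  triangleFree-graph : (∀ u v → T (R u v) → MiddleThird n ∣ u - v ∣) → TriangleFree graph
  triangleFree-graph far u v w (uv , vw , uw) =
    middleThird-noTriangle (toℕ u) (toℕ v) (toℕ w) (far _ _ uv) (far _ _ vw) (far _ _ uw)

-- e x t decides whether x and x + t are adjacent; distanceDegree e v r is the degree of v among
-- the vertices 0, …, v + r.
distanceDegree : (ℕ → ℕ → Bool) → ℕ → ℕ → ℕ
distanceDegree e v r = count v (λ u → e u (v ∸ u)) + count r (λ j → e v (suc j))

count-distanceDegree : ∀ e v r → e v 0 ≡ false →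
                       count (suc (v + r)) (λ u → e (v ⊓ u) ∣ v - u ∣) ≡ distanceDegree e v r
count-distanceDegree e v r e[v,0]≡false = begin
  count (suc v + r) F                                               ≡⟨ ∑<-split (suc v) r _ ⟩
  count v F + iverson (F v) + count r (λ j → F (suc v + j))         ≡⟨ cong₂ (λ x y → x + y + count r (λ j → F (suc v + j)))
                                                                             (∑<-cong v left) self ⟩
  count v (λ u → e u (v ∸ u)) + 0 + count r (λ j → F (suc v + j))   ≡⟨ cong₂ _+_ (+-identityʳ _) (∑<-cong r right) ⟩
  distanceDegree e v r                                              ∎
  where
  open ≡-Reasoning
  F : ℕ → Bool
  F u = e (v ⊓ u) ∣ v - u ∣
  left : ∀ u → u < v → iverson (F u) ≡ iverson (e u (v ∸ u))
  left u u<v = cong iverson (cong₂ e (m≥n⇒m⊓n≡n (<⇒≤ u<v)) (m≤n⇒∣n-m∣≡n∸m (<⇒≤ u<v)))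
  self : iverson (F v) ≡ 0
  self = cong iverson (trans (cong₂ e (⊓-idem v) (∣n-n∣≡0 v)) e[v,0]≡false)
  right : ∀ j → j < r → iverson (F (suc v + j)) ≡ iverson (e v (suc j))
  right j _ = cong iverson (cong₂ e (m≤n⇒m⊓n≡m (m≤n⇒m≤1+n (m≤m+n v j)))
                                    (trans (cong (λ w → ∣ v - w ∣) (sym (+-suc v j))) (∣m-m+n∣≡n v (suc j))))

distanceDegree-+ : ∀ e₁ e₂ e₃ v r → (∀ x t → iverson (e₁ x t) + iverson (e₂ x t) ≡ iverson (e₃ x t)) →
           distanceDegree e₁ v r + distanceDegree e₂ v r ≡ distanceDegree e₃ v r
distanceDegree-+ e₁ e₂ e₃ v r pointwise =
  trans (+-interchange (count v _) (count r _) (count v _) (count r _))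
        (cong₂ _+_ (count-+ v _ _ _ (λ u → pointwise u (v ∸ u)))
                   (count-+ r _ _ _ (λ j → pointwise v (suc j))))

distanceDegree-reflect : ∀ D v r → D 0 ≡ false → (∀ x y → x + y ≡ suc (v + r) → D x ≡ D y) →
                 distanceDegree (λ _ → D) v r ≡ count (suc (v + r)) D
distanceDegree-reflect D v r D0≡false D-reflect = begin
  count v (λ u → D (v ∸ u)) + count r (λ j → D (suc j))       ≡⟨ cong₂ _+_ (∑<-reverse v _ _ distance)
                                                                           (∑<-reverse r _ _ mirror) ⟩
  count v (λ i → D (suc i)) + count r (λ j → D (suc (v + j))) ≡⟨ ∑<-split v r _ ⟨
  count (v + r) (λ t → D (suc t))                             ≡⟨ cong (_+ count (v + r) (λ t → D (suc t)))
                                                                      (cong iverson D0≡false) ⟨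
  iverson (D 0) + count (v + r) (λ t → D (suc t))              ≡⟨ ∑<-shift (v + r) _ ⟨
  count (suc (v + r)) D                                       ∎
  where
  open ≡-Reasoning
  distance : ∀ u i → suc (u + i) ≡ v → iverson (D (v ∸ u)) ≡ iverson (D (suc i))
  distance u i refl = cong (iverson ∘ D) (trans (cong (_∸ u) (sym (+-suc u i))) (m+n∸m≡n u (suc i)))
  mirror : ∀ j i → suc (j + i) ≡ r → iverson (D (suc j)) ≡ iverson (D (suc (v + i)))
  mirror j i refl = cong iverson (D-reflect (suc j) (suc (v + i)) (cong suc (solve (v ∷ j ∷ i ∷ []))))

TriangleFreeGraphWith : (n m x y : ℕ) → Set
TriangleFreeGraphWith n m x y = Σ (Graph n) λ G → TriangleFree G × countDeg G x ≡ m × countDeg G y + m ≡ n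

module MatchedDistanceGraph (n : ℕ) (D : ℕ → Bool)
  (D-reflect : ∀ x y → x + y ≡ n → D x ≡ D y)
  (D-middle : ∀ t → T (D t) → MiddleThird n t)
  (g s : ℕ) (g-middle : MiddleThird n g) (s≤g : s ≤ g) (g+s≤n : g + s ≤ n) where

  matched : ℕ → ℕ → Bool
  matched x t = (x <ᵇ s) ∧ (t ≡ᵇ g)

  edge : ℕ → ℕ → Bool
  edge x t = D t xor matched x t

  R : ℕ → ℕ → Bool
  R u v = edge (u ⊓ v) ∣ u - v ∣

  isMatched : ℕ → Bool
  isMatched v = inRange g (g + s) v ∨ inRange 0 s v

  private
    0<g : 0 < g
    0<g = n<3a⇒0<a (proj₁ g-middle)

    D0≡false : D 0 ≡ false
    D0≡false with D 0 | D-middle 0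
    ... | true  | middle = contradiction (n<3a⇒0<a (proj₁ (middle tt))) (<-irrefl refl)
    ... | false | _      = refl

    matched⇒≡g : ∀ x t → T (matched x t) → t ≡ g
    matched⇒≡g x t x~t = ≡ᵇ⇒≡ t g (proj₂ (Equivalence.to T-∧ x~t))

    edge-0 : ∀ x → edge x 0 ≡ false
    edge-0 x with matched x 0 | matched⇒≡g x 0
    ... | true  | ≡g = contradiction (≡g tt) (<⇒≢ 0<g)
    ... | false | _  = cong (_xor false) D0≡false

    R-sym : ∀ u v → R u v ≡ R v u
    R-sym u v = cong₂ edge (⊓-comm u v) (∣-∣-comm u v)

    R-irrefl : ∀ v → R v v ≡ false
    R-irrefl v = trans (cong₂ edge (⊓-idem v) (∣n-n∣≡0 v)) (edge-0 v)

    R-middle : ∀ u v → T (R u v) → MiddleThird n ∣ u - v ∣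
    R-middle u v uv with D ∣ u - v ∣ in D[t] | matched (u ⊓ v) ∣ u - v ∣ in m[t]
    ... | true  | _    = D-middle _ (subst T (sym D[t]) tt)
    ... | false | true =
      subst (MiddleThird n) (sym (matched⇒≡g (u ⊓ v) ∣ u - v ∣ (subst T (sym m[t]) tt))) g-middle

  open RelationGraph n R R-sym R-irrefl public using (graph)
  open RelationGraph n R R-sym R-irrefl using (countDeg-graph; triangleFree-graph)

  triangleFree : TriangleFree graph
  triangleFree = triangleFree-graph R-middle

  private
    matched-left : ∀ v → count v (λ u → matched u (v ∸ u)) ≡ iverson (inRange g (g + s) v)
    matched-left v with g ≤? v
    ... | no g≰v = trans (count-none v _ unmatched) (cong iverson (sym (inRange-below {b = g + s} (≰⇒> g≰v))))
      where
      unmatched : ∀ u → u < v → matched u (v ∸ u) ≡ false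
      unmatched u _ = trans (cong ((u <ᵇ s) ∧_) (≢⇒≡ᵇ-false (<⇒≢ (≤-<-trans (m∸n≤m v u) (≰⇒> g≰v)))))
                            (∧-zeroʳ (u <ᵇ s))
    ... | yes g≤v with v ∸ g | m+[n∸m]≡n g≤v
    ...   | i | refl = trans (∑<-single (g + i) i _ (+-monoˡ-≤ i 0<g) unmatched) partner
      where
      unmatched : ∀ u → u < g + i → u ≢ i → iverson (matched u (g + i ∸ u)) ≡ 0
      unmatched u u<g+i u≢i =
        cong iverson (trans (cong ((u <ᵇ s) ∧_) (≢⇒≡ᵇ-false g+i∸u≢g)) (∧-zeroʳ (u <ᵇ s)))
        where
        g+i∸u≢g : g + i ∸ u ≢ g
        g+i∸u≢g eq = u≢i (+-cancelˡ-≡ g u i (begin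
          g + u             ≡⟨ cong (_+ u) eq ⟨
          g + i ∸ u + u     ≡⟨ m∸n+n≡m (<⇒≤ u<g+i) ⟩
          g + i             ∎))
          where open ≡-Reasoning
      partner : iverson (matched i (g + i ∸ i)) ≡ iverson (inRange g (g + s) (g + i))
      partner rewrite m+n∸n≡m g i | ≡ᵇ-refl g | inRange-+ g s i = cong iverson (∧-identityʳ (i <ᵇ s))

    matched-right : ∀ v r → suc (v + r) ≡ n → count r (λ j → (v <ᵇ s) ∧ (suc j ≡ᵇ g)) ≡ iverson (v <ᵇ s)
    matched-right v r 1+v+r≡n with v <ᵇ s | <ᵇ-reflects-< v s
    ... | false | _       = count-none r _ (λ _ _ → refl)
    ... | true  | ofʸ v<s = trans (∑<-single r (g ∸ 1) _ g∸1<r unmatched)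
                                  (cong iverson (trans (cong (_≡ᵇ g) 1+[g∸1]≡g) (≡ᵇ-refl g)))
      where
      1+[g∸1]≡g : suc (g ∸ 1) ≡ g
      1+[g∸1]≡g = m+[n∸m]≡n 0<g
      g∸1<r : g ∸ 1 < r
      g∸1<r = subst (_≤ r) (sym 1+[g∸1]≡g) (+-cancelˡ-≤ v g r (s≤s⁻¹ (begin-strict
        v + g       ≡⟨ +-comm v g ⟩
        g + v       <⟨ +-monoʳ-< g v<s ⟩
        g + s       ≤⟨ g+s≤n ⟩
        n           ≡⟨ 1+v+r≡n ⟨
        suc (v + r) ∎)))
        where open ≤-Reasoning
      unmatched : ∀ j → j < r → j ≢ g ∸ 1 → iverson (suc j ≡ᵇ g) ≡ 0
      unmatched j _ j≢g∸1 =
        cong iverson (≢⇒≡ᵇ-false (λ 1+j≡g → j≢g∸1 (suc-injective (trans 1+j≡g (sym 1+[g∸1]≡g)))))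

    distanceDegree-matched : ∀ v r → suc (v + r) ≡ n → distanceDegree matched v r ≡ iverson (isMatched v)
    distanceDegree-matched v r 1+v+r≡n =
      trans (cong₂ _+_ (matched-left v) (matched-right v r 1+v+r≡n)) (iverson-∨ _ (v <ᵇ s) disjoint)
      where
      disjoint : T (inRange g (g + s) v) → T (v <ᵇ s) → ⊥
      disjoint v∈M v<s = <⇒≱ (<-≤-trans (<ᵇ⇒< v s v<s) s≤g) (proj₁ (inRange⁻ {g} {g + s} {v} v∈M))

    count-matched : count n isMatched ≡ s + s
    count-matched =
      trans (count-∨ n _ _ disjoint) (cong₂ _+_ (count-inRange g s g+s≤n) (count-inRange 0 s s≤n))
      where
      s≤n : s ≤ n
      s≤n = ≤-trans (m≤n+m s g) g+s≤n
      disjoint : ∀ v → T (inRange g (g + s) v) → T (inRange 0 s v) → ⊥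
      disjoint v v∈M v<s =
        <⇒≱ (<-≤-trans (proj₂ (inRange⁻ {0} {s} {v} v<s)) s≤g) (proj₁ (inRange⁻ {g} {g + s} {v} v∈M))

    count-R : ∀ v r → suc (v + r) ≡ n → count n (R v) ≡ distanceDegree edge v r
    count-R v r refl = count-distanceDegree edge v r (edge-0 v)

    distanceDegree-D : ∀ v r → suc (v + r) ≡ n → distanceDegree (λ _ → D) v r ≡ count n D
    distanceDegree-D v r refl = distanceDegree-reflect D v r D0≡false D-reflect

    split : ∀ {v} → v < n → Σ ℕ λ r → suc (v + r) ≡ n
    split {v} v<n = n ∸ suc v , m+[n∸m]≡n v<n

    twoDegrees : ∀ {x y} → x ≢ y → (∀ v → v < n → count n (R v) ≡ (if isMatched v then x else y)) →
                 TriangleFreeGraphWith n (s + s) x y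
    twoDegrees {x} {y} x≢y degree≗ with count-dichotomy n (λ v → count n (R v)) isMatched x≢y degree≗
    ... | count-x , count-y+matched = graph , triangleFree ,
      trans (countDeg-graph x) (trans count-x count-matched) ,
      trans (cong₂ _+_ (countDeg-graph y) (sym count-matched)) count-y+matched

  removal : T (D g) → ∀ d → count n D ≡ suc d → TriangleFreeGraphWith n (s + s) d (suc d)
  removal D[g] d count-D = twoDegrees (<⇒≢ (n<1+n d)) degree-removed
    where
    matched⇒D : ∀ x t → T (matched x t) → T (D t)
    matched⇒D x t x~t = subst (T ∘ D) (sym (matched⇒≡g x t x~t)) D[g]
    degree-removed : ∀ v → v < n → count n (R v) ≡ (if isMatched v then d else suc d)
    degree-removed v v<n with split v<n
    ... | r , 1+v+r≡n = iverson-cancelʳ (isMatched v) (begin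
      count n (R v) + iverson (isMatched v)                 ≡⟨ cong₂ _+_ (count-R v r 1+v+r≡n)
                                                                         (sym (distanceDegree-matched v r 1+v+r≡n)) ⟩
      distanceDegree edge v r + distanceDegree matched v r  ≡⟨ distanceDegree-+ edge matched _ v r
                                                                 (λ x t → iverson-xor-cancel (D t) _ (matched⇒D x t)) ⟩
      distanceDegree (λ _ → D) v r                          ≡⟨ distanceDegree-D v r 1+v+r≡n ⟩
      count n D                                             ≡⟨ count-D ⟩
      suc d                                                 ∎)
      where open ≡-Reasoning

  addition : ¬ T (D g) → ∀ d → count n D ≡ d → TriangleFreeGraphWith n (s + s) (suc d) d
  addition ¬D[g] d count-D = twoDegrees (≢-sym (<⇒≢ (n<1+n d))) degree-added
    where
    matched⇒¬D : ∀ x t → T (matched x t) → ¬ T (D t)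
    matched⇒¬D x t x~t = ¬D[g] ∘ subst (T ∘ D) (matched⇒≡g x t x~t)
    degree-added : ∀ v → v < n → count n (R v) ≡ (if isMatched v then suc d else d)
    degree-added v v<n with split v<n
    ... | r , 1+v+r≡n = iverson-offset (isMatched v) (begin
      count n (R v)                                         ≡⟨ count-R v r 1+v+r≡n ⟩
      distanceDegree edge v r                               ≡⟨ distanceDegree-+ (λ _ → D) matched edge v r
                                                                 (λ x t → iverson-xor-disjoint (D t) _ (matched⇒¬D x t)) ⟨
      distanceDegree (λ _ → D) v r + distanceDegree matched v r
                                                            ≡⟨ cong₂ _+_ (distanceDegree-D v r 1+v+r≡n)
                                                                         (distanceDegree-matched v r 1+v+r≡n) ⟩
      count n D + iverson (isMatched v)                     ≡⟨ cong (_+ iverson (isMatched v)) count-D ⟩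
      d + iverson (isMatched v)                             ∎)
      where open ≡-Reasoning

≤-offset : ∀ {x y} k → x + k ≡ y → x ≤ y
≤-offset {x} k refl = m≤m+n x k

a+x≡1+n⇒x≤n : ∀ {a x n} → 0 < a → a + x ≡ suc n → x ≤ n
a+x≡1+n⇒x≤n {a} {x} 0<a a+x≡1+n = s≤s⁻¹ (subst (suc x ≤_) a+x≡1+n (+-monoˡ-≤ x 0<a))

module SymmetricInterval (n a L : ℕ) (a+[a+L]≡1+n : a + (a + L) ≡ suc n) (n<3a : n < 3 * a) where

  D : ℕ → Bool
  D = inRange a (a + L)

  D-reflect : ∀ x y → x + y ≡ n → D x ≡ D y
  D-reflect = inRange-reflect {n} {a} {a + L} {a} {a + L} a+[a+L]≡1+n a+[a+L]≡1+n

  D-middle : ∀ t → T (D t) → MiddleThird n t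
  D-middle = inRange-middleThird {n} {a} {a + L} {a} a+[a+L]≡1+n n<3a n<3a

  count-D : count n D ≡ L
  count-D = count-inRange a L (a+x≡1+n⇒x≤n {a} (n<3a⇒0<a {n} n<3a) a+[a+L]≡1+n)

module SymmetricIntervalPair (n a c w : ℕ) (a+b₂≡1+n : a + (a + c + w + c) ≡ suc n) (n<3a : n < 3 * a) where

  private
    a₂ b₁ b₂ : ℕ
    a₂ = a + c + w
    b₁ = a + c
    b₂ = a + c + w + c

    a₂+b₁≡1+n : a₂ + b₁ ≡ suc n
    a₂+b₁≡1+n = trans a₂+b₁≡a+b₂ a+b₂≡1+n
      where
      a₂+b₁≡a+b₂ : a + c + w + (a + c) ≡ a + (a + c + w + c)
      a₂+b₁≡a+b₂ = solve (a ∷ c ∷ w ∷ [])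

    n<3a₂ : n < 3 * a₂
    n<3a₂ = <-≤-trans n<3a (*-monoʳ-≤ 3 (≤-trans (m≤m+n a c) (m≤m+n (a + c) w)))

  D : ℕ → Bool
  D t = inRange a b₁ t ∨ inRange a₂ b₂ t

  D-reflect : ∀ x y → x + y ≡ n → D x ≡ D y
  D-reflect x y x+y≡n = trans (cong₂ _∨_ (inRange-reflect {n} {a} {b₁} {a₂} {b₂} a+b₂≡1+n a₂+b₁≡1+n x y x+y≡n)
                                         (inRange-reflect {n} {a₂} {b₂} {a} {b₁} a₂+b₁≡1+n a+b₂≡1+n x y x+y≡n))
                              (∨-comm (inRange a₂ b₂ y) (inRange a b₁ y))

  D-middle : ∀ t → T (D t) → MiddleThird n t
  D-middle t t∈D with inRange a b₁ t in t∈I₁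
  ... | true  = inRange-middleThird {n} {a} {b₁} {a₂} a₂+b₁≡1+n n<3a n<3a₂ t (subst T (sym t∈I₁) tt)
  ... | false = inRange-middleThird {n} {a₂} {b₂} {a} a+b₂≡1+n n<3a₂ n<3a t t∈D

  count-D : count n D ≡ c + c
  count-D = trans (count-∨ n _ _ disjoint)
                  (cong₂ _+_ (count-inRange a c (≤-trans (m≤m+n (a + c) w) (≤-trans (m≤m+n (a + c + w) c) b₂≤n)))
                             (count-inRange a₂ c b₂≤n))
    where
    b₂≤n : b₂ ≤ n
    b₂≤n = a+x≡1+n⇒x≤n {a} (n<3a⇒0<a {n} n<3a) a+b₂≡1+n
    disjoint : ∀ t → T (inRange a b₁ t) → T (inRange a₂ b₂ t) → ⊥
    disjoint t t∈I₁ t∈I₂ = <⇒≱ (proj₂ (inRange⁻ {a} {b₁} {t} t∈I₁))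
                               (≤-trans (m≤m+n b₁ w) (proj₁ (inRange⁻ {a₂} {b₂} {t} t∈I₂)))

intervalRemoval : ∀ {n} a k r s → n ≡ a + a + (k + k + r) → k + k + r < a → s ≤ k + a →
                TriangleFreeGraphWith n (s + s) (k + k + r) (suc (k + k + r))
intervalRemoval a k r s refl d<a s≤g = removal D[g] (k + k + r) count-D
  where
  open ≤-Reasoning
  n<3a : a + a + (k + k + r) < 3 * a
  n<3a = begin-strict
    a + a + (k + k + r) <⟨ +-monoʳ-< (a + a) d<a ⟩
    a + a + a           ≡⟨ solve (a ∷ []) ⟩
    3 * a               ∎
  open SymmetricInterval (a + a + (k + k + r)) a (suc (k + k + r)) (solve (a ∷ k ∷ r ∷ [])) n<3a
  g-middle : MiddleThird (a + a + (k + k + r)) (k + a)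
  g-middle = ≤-trans n<3a (*-monoʳ-≤ 3 (m≤n+m a k)) , (begin-strict
    3 * (k + a)                 <⟨ m<m+n (3 * (k + a)) (n<3a⇒0<a {a + a + (k + k + r)} n<3a) ⟩
    3 * (k + a) + a             ≤⟨ ≤-offset (k + r + r) (solve (a ∷ k ∷ r ∷ [])) ⟩
    2 * (a + a + (k + k + r))   ∎)
  g+s≤n : k + a + s ≤ a + a + (k + k + r)
  g+s≤n = begin
    k + a + s                   ≤⟨ +-monoʳ-≤ (k + a) s≤g ⟩
    k + a + (k + a)             ≤⟨ ≤-offset r (solve (a ∷ k ∷ r ∷ [])) ⟩
    a + a + (k + k + r)         ∎
  D[g] : T (D (k + a))
  D[g] = subst T (sym (inRange⁺ {a} {a + suc (k + k + r)} (m≤n+m a k) (≤-offset (k + r) (solve (a ∷ k ∷ r ∷ []))))) tt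
  open MatchedDistanceGraph (a + a + (k + k + r)) D D-reflect D-middle (k + a) s g-middle s≤g g+s≤n

holeAddition : ∀ {n} a k s → n ≡ suc (a + a + (k + k)) → suc (suc (k + k)) ≤ a → s ≤ k + a →
               TriangleFreeGraphWith n (s + s) (suc (k + k)) (k + k)
holeAddition a k s refl 2k+2≤a s≤g = addition ¬D[g] (k + k) count-D
  where
  open ≤-Reasoning
  n<3a : suc (a + a + (k + k)) < 3 * a
  n<3a = begin
    suc (suc (a + a + (k + k))) ≡⟨ solve (a ∷ k ∷ []) ⟩
    a + a + suc (suc (k + k))   ≤⟨ +-monoʳ-≤ (a + a) 2k+2≤a ⟩
    a + a + a                   ≡⟨ solve (a ∷ []) ⟩
    3 * a                       ∎
  open SymmetricIntervalPair (suc (a + a + (k + k))) a k 2 (solve (a ∷ k ∷ [])) n<3a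
  g-middle : MiddleThird (suc (a + a + (k + k))) (k + a)
  g-middle = ≤-trans n<3a (*-monoʳ-≤ 3 (m≤n+m a k)) , ≤-offset (a + k + 1) (solve (a ∷ k ∷ []))
  g+s≤n : k + a + s ≤ suc (a + a + (k + k))
  g+s≤n = begin
    k + a + s                   ≤⟨ +-monoʳ-≤ (k + a) s≤g ⟩
    k + a + (k + a)             ≤⟨ ≤-offset 1 (solve (a ∷ k ∷ [])) ⟩
    suc (a + a + (k + k))       ∎
  ¬D[g] : ¬ T (D (k + a))
  ¬D[g] = subst T (cong₂ _∨_ (inRange-above {a} {a + k} (≤-reflexive (+-comm a k)))
                             (inRange-below {a + k + 2} {a + k + 2 + k} (≤-offset 1 (solve (a ∷ k ∷ [])))))
  open MatchedDistanceGraph (suc (a + a + (k + k))) D D-reflect D-middle (k + a) s g-middle s≤g g+s≤n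

holeRemoval : ∀ {n} a k s → n ≡ a + a + suc (suc (k + k)) → suc (suc (suc (k + k))) ≤ a → s ≤ k + a →
                TriangleFreeGraphWith n (s + s) (suc (k + k)) (suc (suc (k + k)))
holeRemoval a k s refl 2k+3≤a s≤g = removal D[g] (suc (k + k)) (trans count-D (cong suc (+-suc k k)))
  where
  open ≤-Reasoning
  n<3a : a + a + suc (suc (k + k)) < 3 * a
  n<3a = begin
    suc (a + a + suc (suc (k + k))) ≡⟨ solve (a ∷ k ∷ []) ⟩
    a + a + suc (suc (suc (k + k))) ≤⟨ +-monoʳ-≤ (a + a) 2k+3≤a ⟩
    a + a + a                       ≡⟨ solve (a ∷ []) ⟩
    3 * a                           ∎
  open SymmetricIntervalPair (a + a + suc (suc (k + k))) a (suc k) 1 (solve (a ∷ k ∷ [])) n<3a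
  g-middle : MiddleThird (a + a + suc (suc (k + k))) (k + a)
  g-middle = ≤-trans n<3a (*-monoʳ-≤ 3 (m≤n+m a k)) , ≤-offset (a + k + 3) (solve (a ∷ k ∷ []))
  g+s≤n : k + a + s ≤ a + a + suc (suc (k + k))
  g+s≤n = begin
    k + a + s                   ≤⟨ +-monoʳ-≤ (k + a) s≤g ⟩
    k + a + (k + a)             ≤⟨ ≤-offset 2 (solve (a ∷ k ∷ [])) ⟩
    a + a + suc (suc (k + k))   ∎
  D[g] : T (D (k + a))
  D[g] = subst T (sym (cong (_∨ inRange (a + suc k + 1) (a + suc k + 1 + suc k) (k + a))
                            (inRange⁺ {a} {a + suc k} (m≤n+m a k) (≤-offset 0 (solve (a ∷ k ∷ [])))))) tt
  open MatchedDistanceGraph (a + a + suc (suc (k + k))) D D-reflect D-middle (k + a) s g-middle s≤g g+s≤n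

halve-≤ : ∀ {x h} → x + x ≤ h + h → x ≤ h
halve-≤ {x} {h} x+x≤h+h = ≮⇒≥ (λ h<x → <⇒≱ (+-mono-< h<x h<x) x+x≤h+h)

split-centre : ∀ {k x h} → k + x ≤ h → Σ ℕ λ a → h ≡ k + a × x ≤ a
split-centre {k} {x} {h} k+x≤h with h ∸ k | m+[n∸m]≡n (m+n≤o⇒m≤o k k+x≤h)
... | a | refl = a , refl , +-cancelˡ-≤ k x a k+x≤h

Realization : (n x m y m′ : ℕ) → Set
Realization n x m y m′ = Σ (Graph n) λ G → TriangleFree G × countDeg G x ≡ m × countDeg G y ≡ m′

realization : ∀ {n m m′ x y} → m + m′ ≡ n → TriangleFreeGraphWith n m x y → Realization n x m y m′
realization {m = m} {m′} m+m′≡n (G , triangleFree , count-x , count-y+m) =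
  G , triangleFree , count-x , +-cancelʳ-≡ m _ m′ (trans count-y+m (trans (sym m+m′≡n) (+-comm m m′)))

realization-swap : ∀ {n x m y m′} → Realization n x m y m′ → Realization n y m′ x m
realization-swap (G , triangleFree , count-x , count-y) = G , triangleFree , count-y , count-x

sameParityGraph : ∀ {n d p} h k r s → p + (s + s) ≡ n → n ≡ h + h + r → d ≡ k + k + r →
                  suc (3 * suc d + 3 * d) < n → s ≤ h → Realization n (suc d) p d (s + s)
sameParityGraph {p = p} h k r s p+2s≡n refl refl bound s≤h with split-centre {k} centre≤h
  where
  centre≤h : k + suc (k + k + r) ≤ h
  centre≤h = halve-≤ (+-cancelʳ-≤ r _ (h + h) (begin
    k + suc (k + k + r) + (k + suc (k + k + r)) + r ≤⟨ ≤-offset (3 * (k + k + r) + 2) (solve (k ∷ r ∷ [])) ⟩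
    suc (3 * suc (k + k + r) + 3 * (k + k + r))     ≤⟨ <⇒≤ bound ⟩
    h + h + r                                       ∎))
    where open ≤-Reasoning
... | a , refl , d<a = realization-swap (realization (trans (+-comm (s + s) p) p+2s≡n)
  (intervalRemoval {k + a + (k + a) + r} a k r s (solve (a ∷ k ∷ r ∷ [])) d<a s≤h))

oddOrderEvenDegreeGraph : ∀ {n d q} h k s → s + s + q ≡ n → n ≡ suc (h + h) → d ≡ k + k →
                          suc (3 * suc d + 3 * d) < n → s ≤ h → Realization n (suc d) (s + s) d q
oddOrderEvenDegreeGraph h k s 2s+q≡n refl refl bound s≤h with split-centre {k} centre≤h
  where
  centre≤h : k + suc (suc (k + k)) ≤ h
  centre≤h = halve-≤ (begin
    k + suc (suc (k + k)) + (k + suc (suc (k + k))) ≤⟨ ≤-offset (6 * k) (solve (k ∷ [])) ⟩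
    suc (3 * suc (k + k) + 3 * (k + k))             ≤⟨ s≤s⁻¹ bound ⟩
    h + h                                           ∎)
    where open ≤-Reasoning
... | a , refl , 2k+2≤a = realization 2s+q≡n
  (holeAddition {suc (k + a + (k + a))} a k s (solve (a ∷ k ∷ [])) 2k+2≤a s≤h)

evenOrderOddDegreeGraph : ∀ {n d p} h k s → p + (s + s) ≡ n → n ≡ h + h → d ≡ suc (k + k) →
                          suc (3 * suc d + 3 * d) < n → s < h → Realization n (suc d) p d (s + s)
evenOrderOddDegreeGraph {p = p} h k s p+2s≡n refl refl bound s<h with split-centre {suc k} centre≤h
  where
  centre≤h : suc k + suc (suc (suc (k + k))) ≤ h
  centre≤h = halve-≤ (begin
    suc k + suc (suc (suc (k + k))) + (suc k + suc (suc (suc (k + k)))) ≤⟨ ≤-offset (6 * k + 3) (solve (k ∷ [])) ⟩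
    suc (suc (3 * suc (suc (k + k)) + 3 * suc (k + k)))                 ≤⟨ bound ⟩
    h + h                                                               ∎)
    where open ≤-Reasoning
... | a , refl , 2k+3≤a = realization-swap (realization (trans (+-comm (s + s) p) p+2s≡n)
  (holeRemoval {suc k + a + (suc k + a)} a k s (solve (a ∷ k ∷ [])) 2k+3≤a (s≤s⁻¹ s<h)))

evenOrderOddDegreeRegular : ∀ {n d} h k → n ≡ h + h → d ≡ suc (k + k) → suc (3 * suc d + 3 * d) < n →
                            Realization n (suc d) 0 d n
evenOrderOddDegreeRegular {n} h k n≡h+h refl bound
  with sameParityGraph h k 0 0 (+-identityʳ n) (trans n≡h+h (sym (+-identityʳ (h + h))))
                       (sym (+-identityʳ (k + k))) smaller-bound z≤n
  where
  smaller-bound : suc (3 * suc (k + k) + 3 * (k + k)) < n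
  smaller-bound =
    ≤-<-trans (s≤s (+-mono-≤ (*-monoʳ-≤ 3 (n≤1+n (suc (k + k)))) (*-monoʳ-≤ 3 (n≤1+n (k + k))))) bound
... | G , triangleFree , count-d≡n , _ = G , triangleFree , n≤0⇒n≡0 none , count-d≡n
  where
  none : countDeg G (suc (suc (k + k))) ≤ 0
  none = +-cancelʳ-≤ n _ 0 (begin
    countDeg G (suc (suc (k + k))) + n                         ≡⟨ cong (countDeg G (suc (suc (k + k))) +_) count-d≡n ⟨
    countDeg G (suc (suc (k + k))) + countDeg G (suc (k + k))  ≤⟨ countDeg-distinct G (≢-sym (<⇒≢ (n<1+n _))) ⟩
    n                                                          ∎)
    where open ≤-Reasoning

data Parity : ℕ → Set where
  even : ∀ k → Parity (k + k)
  odd  : ∀ k → Parity (suc (k + k))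

parity : ∀ n → Parity n
parity zero    = even 0
parity (suc n) with parity n
... | even k = odd k
... | odd k  = subst Parity (cong suc (+-suc k k)) (even (suc k))

2∤odd : ∀ k → ¬ 2 ∣ suc (k + k)
2∤odd k (divides q 1+2k≡2q) = odd≢even k q 1+2k≡2q
  where
  odd≢even : ∀ k q → suc (k + k) ≢ q * 2
  odd≢even zero    zero    ()
  odd≢even zero    (suc q) ()
  odd≢even (suc k) zero    ()
  odd≢even (suc k) (suc q) eq = odd≢even k q (trans (sym (+-suc k k)) (suc-injective (suc-injective eq)))

construct : ∀ {n} d p q → p + q ≡ n → 2 ∣ p * suc d + q * d → suc (3 * suc d + 3 * d) < n →
            Realization n (suc d) p d q
construct d p q p+q≡n 2∣sum bound with parity d | parity p | parity q
... | odd k  | _             | odd q′  =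
  contradiction (subst (2 ∣_) odd-sum 2∣sum) (2∤odd (p * suc k + q′ * suc (k + k) + k))
  where
  odd-sum : p * suc (suc (k + k)) + suc (q′ + q′) * suc (k + k)
          ≡ suc (p * suc k + q′ * suc (k + k) + k + (p * suc k + q′ * suc (k + k) + k))
  odd-sum = solve (p ∷ k ∷ q′ ∷ [])
... | even k | odd p′        | _       =
  contradiction (subst (2 ∣_) odd-sum 2∣sum) (2∤odd (p′ * suc (k + k) + k + q * k))
  where
  odd-sum : suc (p′ + p′) * suc (k + k) + q * (k + k)
          ≡ suc (p′ * suc (k + k) + k + q * k + (p′ * suc (k + k) + k + q * k))
  odd-sum = solve (p′ ∷ k ∷ q ∷ [])
... | odd k  | odd p′        | even q′ =
  sameParityGraph (p′ + q′) k 1 q′ p+q≡n (trans (sym p+q≡n) (solve (p′ ∷ q′ ∷ []))) (+-comm 1 (k + k)) bound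
                  (m≤n+m q′ p′)
... | even k | even p′       | even q′ =
  sameParityGraph (p′ + q′) k 0 q′ p+q≡n (trans (sym p+q≡n) (solve (p′ ∷ q′ ∷ []))) (sym (+-identityʳ (k + k))) bound
                  (m≤n+m q′ p′)
... | even k | even p′       | odd q′  =
  oddOrderEvenDegreeGraph (p′ + q′) k p′ p+q≡n (trans (sym p+q≡n) (solve (p′ ∷ q′ ∷ []))) refl bound
                          (m≤m+n p′ q′)
... | odd k  | even zero     | even q′ =
  -- a removal would need g = n/2 ∈ D, which an even-size symmetric D on even n avoids
  subst (Realization _ _ 0 _) (sym p+q≡n) (evenOrderOddDegreeRegular q′ k (sym p+q≡n) refl bound)
... | odd k  | even (suc p″) | even q′ =
  evenOrderOddDegreeGraph (suc p″ + q′) k q′ p+q≡n (trans (sym p+q≡n) (solve (p″ ∷ q′ ∷ []))) refl bound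
                          (s≤s (m≤n+m q′ p″))

isABGraph : ∀ {α a β b} → a ≢ b → Realization (α + β) a α b β → Σ (Graph (α + β)) (IsABGraph α a β b)
isABGraph {a = a} {b = b} a≢b (G , triangleFree , count-a , count-b) with a ≟ b
... | yes a≡b = contradiction a≡b a≢b
... | no _    = G , triangleFree , count-a , count-b

lemma5p3 : (α a β b : ℕ) →
    (a ≡ suc b ⊎ b ≡ suc a) →
    2 ∣ (α * a + β * b) →
    suc (3 * a + 3 * b) < α + β →
    Σ (Graph (α + β)) (λ G → IsABGraph α a β b G)
lemma5p3 α a β b (inj₁ refl) 2∣sum bound =
  isABGraph (≢-sym (<⇒≢ (n<1+n b))) (construct b α β refl 2∣sum bound)
lemma5p3 α a β b (inj₂ refl) 2∣sum bound =
  isABGraph (<⇒≢ (n<1+n a)) (realization-swap (construct a β α (+-comm β α)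
    (subst (2 ∣_) (+-comm (α * a) (β * suc a)) 2∣sum)
    (subst (λ x → suc x < α + β) (+-comm (3 * a) (3 * suc a)) bound)))
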